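{- If $G$ is a König–Egerváry graph, then (i) $\xi(G)+\eta(G)\le\alpha(G)$; (ii) $\sigma(G)+\eta(G)\le\mu(G)$; (iii) $\xi(G)+2\eta(G)+\sigma(G)\le n(G)$.
   Context: All graphs are finite and simple; "graph" means a connected graph with at least one edge. $\alpha(G)$ is the stability number, $\mu(G)$ the maximum matching size, $n(G)=|V(G)|$; $G$ is König–Egerváry if $\alpha(G)+\mu(G)=n(G)$. $\Omega(G)$ is the set of maximum stable sets, $\mathrm{core}(G)=\bigcap\{S:S\in\Omega(G)\}$, $\xi(G)=|\mathrm{core}(G)|$, $\sigma(G)=\left|\bigcap\{V(G)-S:S\in\Omega(G)\}\right|$. An edge $e$ is $\alpha$-critical if $\alpha(G-e)>\alpha(G)$ ($G-e$ being $G$ with $e$ deleted), and $\eta(G)$ is the number of $\alpha$-critical edges of $G$. -}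

module Defs where

open import Data.Nat using (ℕ; zero; suc; _+_; _⊔_; _<ᵇ_; _≡ᵇ_)
open import Data.Bool using (Bool; true; false; _∧_; _∨_; not; if_then_else_)
open import Data.Fin using (Fin; zero; suc; toℕ; _≟_)
open import Data.Fin.Subset using (Subset; ∣_∣)
open import Data.Vec using (Vec; []; _∷_; lookup)
open import Data.List using (List; []; _∷_; map; filter; foldr; length; allFin; concatMap)
open import Data.Product using (_×_; _,_; proj₁; proj₂; ∃; ∃-syntax)
open import Relation.Nullary.Decidable using (⌊_⌋)
open import Relation.Binary.PropositionalEquality using (_≡_)

Adj : ℕ → Set
Adj n = Fin n → Fin n → Bool

data Reach {n : ℕ} (A : Adj n) : Fin n → Fin n → Set where
  here : ∀ {i} → Reach A i i
  step : ∀ {i j k} → A i j ≡ true → Reach A j k → Reach A i k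

-- "graph" in the paper's sense: finite, simple, connected, with at least one edge.
record Graph : Set where
  field
    n       : ℕ
    adj     : Adj n
    sym     : ∀ i j → adj i j ≡ adj j i
    irrefl  : ∀ i → adj i i ≡ false
    connected : ∀ i j → Reach adj i j
    hasEdge : ∃[ i ] ∃[ j ] (adj i j ≡ true)
open Graph public

all : ∀ {A : Set} → (A → Bool) → List A → Bool
all p [] = true
all p (x ∷ xs) = p x ∧ all p xs

allSubsets : (n : ℕ) → List (Subset n)
allSubsets zero = [] ∷ []
allSubsets (suc n) = concatMap (λ s → (false ∷ s) ∷ (true ∷ s) ∷ []) (allSubsets n)

_∈ᵇ_ : ∀ {n} → Fin n → Subset n → Bool
i ∈ᵇ S = lookup S i

isStable : ∀ {n} → Adj n → Subset n → Bool
isStable {n} A S = all (λ i → all (λ j → not (i ∈ᵇ S ∧ j ∈ᵇ S ∧ A i j)) (allFin n)) (allFin n)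

maximum : List ℕ → ℕ
maximum = foldr _⊔_ 0

αA : ∀ {n} → Adj n → ℕ
αA {n} A = maximum (map ∣_∣ (filter (λ S → isStable A S Data.Bool.≟ true) (allSubsets n)))
  where import Data.Bool

α : Graph → ℕ
α G = αA (adj G)

Ω : (G : Graph) → List (Subset (n G))
Ω G = filter (λ S → (isStable (adj G) S ∧ (∣ S ∣ ≡ᵇ α G)) Data.Bool.≟ true) (allSubsets (n G))
  where import Data.Bool

count : ∀ {n} → (Fin n → Bool) → ℕ
count {n} p = length (filter (λ i → p i Data.Bool.≟ true) (allFin n))
  where import Data.Bool

ξ : Graph → ℕ
ξ G = count (λ i → all (λ S → i ∈ᵇ S) (Ω G))

σ : Graph → ℕ
σ G = count (λ i → all (λ S → not (i ∈ᵇ S)) (Ω G))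

-- edges of G, each listed once as (i , j) with i < j
Edge : ℕ → Set
Edge n = Fin n × Fin n

edges : (G : Graph) → List (Edge (n G))
edges G = filter (λ e → ((toℕ (proj₁ e) <ᵇ toℕ (proj₂ e)) ∧ adj G (proj₁ e) (proj₂ e)) Data.Bool.≟ true)
                 (concatMap (λ i → map (λ j → (i , j)) (allFin (n G))) (allFin (n G)))
  where import Data.Bool

sublists : ∀ {A : Set} → List A → List (List A)
sublists [] = [] ∷ []
sublists (x ∷ xs) = concatMap (λ ys → ys ∷ (x ∷ ys) ∷ []) (sublists xs)

_==_ : ∀ {n} → Fin n → Fin n → Bool
i == j = ⌊ i ≟ j ⌋

disjointᵇ : ∀ {n} → Edge n → Edge n → Bool
disjointᵇ (a , b) (c , d) = not (a == c ∨ a == d ∨ b == c ∨ b == d)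

isMatching : ∀ {n} → List (Edge n) → Bool
isMatching [] = true
isMatching (e ∷ es) = all (disjointᵇ e) es ∧ isMatching es

μ : Graph → ℕ
μ G = maximum (map length (filter (λ M → isMatching M Data.Bool.≟ true) (sublists (edges G))))
  where import Data.Bool

deleteEdge : ∀ {n} → Adj n → Edge n → Adj n
deleteEdge A (u , v) i j = A i j ∧ not ((i == u ∧ j == v) ∨ (i == v ∧ j == u))

isαCritical : (G : Graph) → Edge (n G) → Bool
isαCritical G e = α G <ᵇ αA (deleteEdge (adj G) e)

η : Graph → ℕ
η G = length (filter (λ e → isαCritical G e Data.Bool.≟ true) (edges G))
  where import Data.Bool

IsKE : Graph → Set
IsKE G = α G + μ G ≡ n G

{-# OPTIONS --safe #-}
-- Fix a maximum stable set S and a maximum matching M of G.  If Q ⊆ P and every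
-- edge of a matching L has an endpoint in P − Q, then |Q| + |L| ≤ |P|, since the
-- edges of L have pairwise distinct such endpoints.
--
-- If e = uv is α-critical, G − e has a stable set T with |T| > α(G).  It contains
-- u and v (otherwise it would be stable in G), so T − u and T − v are maximum
-- stable sets of G; hence u and v lie neither in core(G) nor in
-- anticore(G) = ⋂{V − S}.  When α + μ = n, every α-critical edge lies in M: otherwise
-- M is also a matching of G − e, and |T| + |M| > n contradicts the bound above with
-- P = V − T.  So the α-critical edges form a matching.  Also |V − S| = μ = |M| and
-- each edge of M needs its own vertex of V − S, so no edge of M has both endpoints
-- outside S.  The bound with P = S, Q = core(G) gives (i), with P = V − S,
-- Q = anticore(G) it gives (ii), and (iii) is their sum.

module Submission where

open import Defs hiding (sym)
open import Data.Bool using (Bool; true; false; not; _∧_)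
import Data.Bool as Bool
open import Data.Bool.Properties using (T-≡; ¬-not; not-involutive)
open import Data.Fin using (Fin; zero; suc; toℕ)
import Data.Fin as Fin
open import Data.Fin.Subset using (Subset; inside; outside; _∈_; _∉_; _⊆_; ∣_∣; ∁; ⁅_⁆; _-_)
  renaming (⊥ to ∅)
open import Data.Fin.Subset.Properties
  using (_∈?_; ∉⊥; ∣⊥∣≡0; ⊥⊆; ∣p∣≤n; ∣∁p∣≡n∸∣p∣; x∉p⇒x∈∁p; x∈∁p⇒x∉p; p─⊥≡p; p─q⊆p;
         x∈p∧x≢y⇒x∈p-y; x∈p⇒∣p-x∣<∣p∣; p⊆q⇒∣p∣≤∣q∣; ∣⁅x⁆∣≡1; x∈⁅y⁆⇒x≡y)
open import Data.List using (List; []; _∷_; length; map; filter; concatMap; allFin)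
import Data.List as List
open import Data.List.Membership.Propositional using (find) renaming (_∈_ to _∈ₗ_)
open import Data.List.Membership.Propositional.Properties
  using (∈-allFin; ∈-filter⁺; ∈-filter⁻; ∈-map⁺; ∈-map⁻; ∈-concatMap⁺; ∈-concatMap⁻; foldr-selective)
open import Data.List.Relation.Binary.Subset.Propositional using () renaming (_⊆_ to _⊆ₗ_)
open import Data.List.Relation.Unary.All as All using (All; []; _∷_)
open import Data.List.Relation.Unary.AllPairs using (AllPairs; []; _∷_)
open import Data.List.Relation.Unary.Any as Any using (here; there)
open import Data.List.Relation.Unary.Unique.Propositional using (Unique)
import Data.List.Relation.Unary.Unique.Propositional.Properties as Unique
open import Data.Nat using (ℕ; zero; suc; _+_; _*_; _∸_; _≤_; _<_; _⊔_; _≡ᵇ_; s≤s⁻¹)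
open import Data.Nat.Properties
open import Data.Nat.Solver using (module +-*-Solver)
open import Data.Product using (_×_; _,_; proj₁; proj₂; ∃-syntax)
open import Data.Product.Properties using (≡-dec)
open import Data.Sum using (_⊎_; inj₁; inj₂)
open import Data.Vec using ([]; _∷_; here; there; tabulate; lookup)
open import Data.Vec.Properties using (lookup∘tabulate; []=⇒lookup; lookup⇒[]=)
open import Function using (_∘_; id; _$_)
open import Function.Bundles using (Equivalence)
open import Relation.Nullary using (¬_; yes; no; contradiction)
open import Relation.Nullary.Decidable using (toWitness)
open import Relation.Binary.PropositionalEquality
open import Relation.Binary.Definitions using (DecidableEquality)

open Equivalence using (to; from)

∧-true : ∀ {a b} → a ∧ b ≡ true → a ≡ true × b ≡ true
∧-true {true} b≡true = refl , b≡true

all-sound : ∀ {A : Set} {p : A → Bool} {xs} → all p xs ≡ true → All (λ x → p x ≡ true) xs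
all-sound {xs = []} _ = []
all-sound {xs = x ∷ xs} h = proj₁ (∧-true h) ∷ all-sound (proj₂ (∧-true h))

all-complete : ∀ {A : Set} {p : A → Bool} {xs} → All (λ x → p x ≡ true) xs → all p xs ≡ true
all-complete [] = refl
all-complete (px ∷ ps) rewrite px = all-complete ps

==-sound : ∀ {n} {i j : Fin n} → (i == j) ≡ true → i ≡ j
==-sound {i = i} {j} h = toWitness {a? = i Fin.≟ j} (T-≡ .from h)

==∧==-sound : ∀ {n} {i j k l : Fin n} → (i == k ∧ j == l) ≡ true → i ≡ k × j ≡ l
==∧==-sound h = ==-sound (proj₁ (∧-true h)) , ==-sound (proj₂ (∧-true h))

∈⇒≤maximum : ∀ {x xs} → x ∈ₗ xs → x ≤ maximum xs
∈⇒≤maximum {xs = y ∷ xs} (here refl) = m≤m⊔n y (maximum xs)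
∈⇒≤maximum {xs = y ∷ xs} (there x∈xs) = m≤n⇒m≤o⊔n y (∈⇒≤maximum x∈xs)

maximum-attained : ∀ {A : Set} (f : A → ℕ) xs →
  maximum (map f xs) ≡ 0 ⊎ ∃[ x ] (x ∈ₗ xs × f x ≡ maximum (map f xs))
maximum-attained f xs with foldr-selective ⊔-sel 0 (map f xs)
... | inj₁ max≡0 = inj₁ max≡0
... | inj₂ max∈ with ∈-map⁻ f max∈
...   | x , x∈xs , max≡fx = inj₂ (x , x∈xs , sym max≡fx)

∈-allSubsets : ∀ {n} (S : Subset n) → S ∈ₗ allSubsets n
∈-allSubsets [] = here refl
∈-allSubsets (false ∷ S) = ∈-concatMap⁺ _ (Any.map (λ { refl → here refl }) (∈-allSubsets S))
∈-allSubsets (true ∷ S) = ∈-concatMap⁺ _ (Any.map (λ { refl → there (here refl) }) (∈-allSubsets S))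

sublists-⊆ : ∀ {A : Set} (xs : List A) {ys} → ys ∈ₗ sublists xs → ys ⊆ₗ xs
sublists-⊆ [] (here refl) ()
sublists-⊆ (x ∷ xs) ys∈ with find (∈-concatMap⁻ _ {xs = sublists xs} ys∈)
... | zs , zs∈ , here refl = there ∘ sublists-⊆ xs zs∈
... | zs , zs∈ , there (here refl) = λ where
  (here refl) → here refl
  (there y∈zs) → there (sublists-⊆ xs zs∈ y∈zs)

concatMap-pairs≡cartesianProduct : ∀ {A B : Set} (xs : List A) (ys : List B) →
  concatMap (λ x → map (x ,_) ys) xs ≡ List.cartesianProduct xs ys
concatMap-pairs≡cartesianProduct [] ys = refl
concatMap-pairs≡cartesianProduct (x ∷ xs) ys =
  cong (map (x ,_) ys List.++_) (concatMap-pairs≡cartesianProduct xs ys)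

count-tabulate : ∀ {m n} (p : Fin m → Bool) (f : Fin n → Fin m) →
  length (filter (λ i → p i Bool.≟ true) (List.tabulate f)) ≡ ∣ tabulate (p ∘ f) ∣
count-tabulate {n = zero} p f = refl
count-tabulate {n = suc n} p f with p (f zero)
... | true = cong suc (count-tabulate p (f ∘ suc))
... | false = count-tabulate p (f ∘ suc)

count≡∣tabulate∣ : ∀ {n} (p : Fin n → Bool) → count p ≡ ∣ tabulate p ∣
count≡∣tabulate∣ p = count-tabulate p id

∈-tabulate⁻ : ∀ {n} {p : Fin n → Bool} {i} → i ∈ tabulate p → p i ≡ true
∈-tabulate⁻ {p = p} {i} i∈ = trans (sym (lookup∘tabulate p i)) ([]=⇒lookup i∈)

x∉p-x : ∀ {n} (p : Subset n) (x : Fin n) → x ∉ p - x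
x∉p-x (_ ∷ p) zero ()
x∉p-x (_ ∷ p) (suc x) (there x∈) = x∉p-x p x x∈

∣p∣≡1+∣p-x∣ : ∀ {n} {p : Subset n} {x} → x ∈ p → ∣ p ∣ ≡ suc ∣ p - x ∣
∣p∣≡1+∣p-x∣ {p = inside ∷ p} here = cong (suc ∘ ∣_∣) (sym (p─⊥≡p p))
∣p∣≡1+∣p-x∣ {p = outside ∷ p} (there x∈p) = ∣p∣≡1+∣p-x∣ x∈p
∣p∣≡1+∣p-x∣ {p = inside ∷ p} (there x∈p) = cong suc (∣p∣≡1+∣p-x∣ x∈p)

-- Stable sets

Stable : ∀ {n} → Adj n → Subset n → Set
Stable A S = ∀ {i j} → i ∈ S → j ∈ S → A i j ≡ false

isStable-sound : ∀ {n} {A : Adj n} {S} → isStable A S ≡ true → Stable A S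
isStable-sound {A = A} {S} h {i} {j} i∈S j∈S
  with entry ← All.lookup (all-sound (All.lookup (all-sound h) (∈-allFin i))) (∈-allFin j)
  rewrite []=⇒lookup i∈S | []=⇒lookup j∈S = trans (sym (not-involutive (A i j))) (cong not entry)

isStable-complete : ∀ {n} {A : Adj n} {S} → Stable A S → isStable A S ≡ true
isStable-complete {n} {A} {S} st =
  all-complete {xs = allFin n} $ All.tabulate λ {i} _ →
    all-complete {xs = allFin n} $ All.tabulate λ {j} _ → entry i j
  where
  entry : ∀ i j → not (lookup S i ∧ lookup S j ∧ A i j) ≡ true
  entry i j with lookup S i in Si | lookup S j in Sj
  ... | false | _ = refl
  ... | true | false = refl
  ... | true | true = cong not (st (lookup⇒[]= i S Si) (lookup⇒[]= j S Sj))

stable-size≤αA : ∀ {n} {A : Adj n} {S} → Stable A S → ∣ S ∣ ≤ αA A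
stable-size≤αA {A = A} {S} st = ∈⇒≤maximum $ ∈-map⁺ ∣_∣ $
  ∈-filter⁺ (λ S → isStable A S Bool.≟ true) (∈-allSubsets S) (isStable-complete st)

αA-attained : ∀ {n} (A : Adj n) → ∃[ S ] (Stable A S × ∣ S ∣ ≡ αA A)
αA-attained {n} A with maximum-attained ∣_∣ (filter (λ S → isStable A S Bool.≟ true) (allSubsets n))
... | inj₁ max≡0 = ∅ , (λ i∈∅ → contradiction i∈∅ ∉⊥) , trans (∣⊥∣≡0 n) (sym max≡0)
... | inj₂ (S , S∈ , ∣S∣≡max) =
  S , isStable-sound (proj₂ (∈-filter⁻ _ {xs = allSubsets n} S∈)) , ∣S∣≡max

∈Ω⁺ : (G : Graph) {S : Subset (n G)} → Stable (adj G) S → ∣ S ∣ ≡ α G → S ∈ₗ Ω G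
∈Ω⁺ G {S} st ∣S∣≡α =
  ∈-filter⁺ (λ S → (isStable (adj G) S ∧ (∣ S ∣ ≡ᵇ α G)) Bool.≟ true) (∈-allSubsets S)
    (cong₂ _∧_ (isStable-complete st) (T-≡ .to (≡⇒≡ᵇ ∣ S ∣ (α G) ∣S∣≡α)))

∈Ω⁻ : (G : Graph) {S : Subset (n G)} → S ∈ₗ Ω G → Stable (adj G) S × ∣ S ∣ ≡ α G
∈Ω⁻ G {S} S∈Ω with ∧-true (proj₂ (∈-filter⁻ _ {xs = allSubsets (n G)} S∈Ω))
... | stable , size = isStable-sound stable , ≡ᵇ⇒≡ ∣ S ∣ (α G) (T-≡ .from size)

maximum-stable : (G : Graph) → ∃[ S ] (S ∈ₗ Ω G)
maximum-stable G with αA-attained (adj G)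
... | S , st , ∣S∣≡α = S , ∈Ω⁺ G st ∣S∣≡α

core : (G : Graph) → Subset (n G)
core G = tabulate (λ i → all (λ S → i ∈ᵇ S) (Ω G))

anticore : (G : Graph) → Subset (n G)
anticore G = tabulate (λ i → all (λ S → not (i ∈ᵇ S)) (Ω G))

ξ≡∣core∣ : (G : Graph) → ξ G ≡ ∣ core G ∣
ξ≡∣core∣ G = count≡∣tabulate∣ (λ i → all (λ S → i ∈ᵇ S) (Ω G))

σ≡∣anticore∣ : (G : Graph) → σ G ≡ ∣ anticore G ∣
σ≡∣anticore∣ G = count≡∣tabulate∣ (λ i → all (λ S → not (i ∈ᵇ S)) (Ω G))

core⊆ : (G : Graph) {S : Subset (n G)} → S ∈ₗ Ω G → core G ⊆ S
core⊆ G {S} S∈Ω {i} i∈core = lookup⇒[]= i S (All.lookup (all-sound (∈-tabulate⁻ i∈core)) S∈Ω)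

anticore⊆∁ : (G : Graph) {S : Subset (n G)} → S ∈ₗ Ω G → anticore G ⊆ ∁ S
anticore⊆∁ G {S} S∈Ω {i} i∈anticore = x∉p⇒x∈∁p λ i∈S →
  contradiction (trans (sym (cong not ([]=⇒lookup i∈S))) i∉S) λ ()
  where
  i∉S : not (lookup S i) ≡ true
  i∉S = All.lookup (all-sound (∈-tabulate⁻ i∈anticore)) S∈Ω

-- Matchings

_∈ₑ_ : ∀ {n} → Fin n → Edge n → Set
x ∈ₑ e = x ≡ proj₁ e ⊎ x ≡ proj₂ e

Disjoint : ∀ {n} → Edge n → Edge n → Set
Disjoint e f = ∀ {x} → x ∈ₑ e → ¬ x ∈ₑ f

Matching : ∀ {n} → List (Edge n) → Set
Matching = AllPairs Disjoint

_≟ₑ_ : ∀ {n} → DecidableEquality (Edge n)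
_≟ₑ_ = ≡-dec Fin._≟_ Fin._≟_

disjointᵇ-sound : ∀ {n} (e f : Edge n) → disjointᵇ e f ≡ true → Disjoint e f
disjointᵇ-sound (a , b) (c , d) h x∈e x∈f
  with a Fin.≟ c | a Fin.≟ d | b Fin.≟ c | b Fin.≟ d | x∈e | x∈f
... | no a≢c | _ | _ | _ | inj₁ refl | inj₁ refl = a≢c refl
... | _ | no a≢d | _ | _ | inj₁ refl | inj₂ refl = a≢d refl
... | _ | _ | no b≢c | _ | inj₂ refl | inj₁ refl = b≢c refl
... | _ | _ | _ | no b≢d | inj₂ refl | inj₂ refl = b≢d refl
disjointᵇ-sound (a , b) (c , d) () _ _ | yes _ | _ | _ | _ | _ | _
disjointᵇ-sound (a , b) (c , d) () _ _ | no _ | yes _ | _ | _ | _ | _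
disjointᵇ-sound (a , b) (c , d) () _ _ | no _ | no _ | yes _ | _ | _ | _
disjointᵇ-sound (a , b) (c , d) () _ _ | no _ | no _ | no _ | yes _ | _ | _

isMatching-sound : ∀ {n} {M : List (Edge n)} → isMatching M ≡ true → Matching M
isMatching-sound {M = []} _ = []
isMatching-sound {M = e ∷ M} h with ∧-true h
... | disjoint , matching = All.map (disjointᵇ-sound e _) (all-sound disjoint) ∷ isMatching-sound matching

matching-disjoint : ∀ {n} {M : List (Edge n)} {e f} → Matching M → e ∈ₗ M → f ∈ₗ M → e ≢ f →
  Disjoint e f
matching-disjoint (_ ∷ _) (here refl) (here refl) e≢f = contradiction refl e≢f
matching-disjoint (d ∷ _) (here refl) (there f∈M) _ = All.lookup d f∈M
matching-disjoint (d ∷ _) (there e∈M) (here refl) _ = λ x∈e x∈f → All.lookup d e∈M x∈f x∈e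
matching-disjoint (_ ∷ m) (there e∈M) (there f∈M) e≢f = matching-disjoint m e∈M f∈M e≢f

matching-⊆ : ∀ {n} {L M : List (Edge n)} → Unique L → L ⊆ₗ M → Matching M → Matching L
matching-⊆ [] _ _ = []
matching-⊆ (distinct ∷ unique) L⊆M m =
  All.tabulate (λ f∈L → matching-disjoint m (L⊆M (here refl)) (L⊆M (there f∈L)) (All.lookup distinct f∈L)) ∷
  matching-⊆ unique (L⊆M ∘ there) m

matching-bound : ∀ {n} {P Q : Subset n} {L : List (Edge n)} → Q ⊆ P → Matching L →
  All (λ e → ∃[ x ] (x ∈ₑ e × x ∈ P × x ∉ Q)) L → ∣ Q ∣ + length L ≤ ∣ P ∣
matching-bound {P = P} {Q} Q⊆P [] [] = subst (_≤ ∣ P ∣) (sym (+-identityʳ ∣ Q ∣)) (p⊆q⇒∣p∣≤∣q∣ Q⊆P)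
matching-bound {P = P} {Q} {_ ∷ L} Q⊆P (disjoint ∷ m) ((x , x∈e , x∈P , x∉Q) ∷ hits) =
  subst (_≤ ∣ P ∣) (sym (+-suc ∣ Q ∣ (length L)))
    (≤-<-trans (matching-bound Q⊆P-x m (All.zipWith hits-P-x (disjoint , hits))) (x∈p⇒∣p-x∣<∣p∣ x∈P))
  where
  Q⊆P-x : Q ⊆ P - x
  Q⊆P-x y∈Q = x∈p∧x≢y⇒x∈p-y (Q⊆P y∈Q) λ { refl → x∉Q y∈Q }
  hits-P-x : ∀ {f} → Disjoint _ f × ∃[ y ] (y ∈ₑ f × y ∈ P × y ∉ Q) →
             ∃[ y ] (y ∈ₑ f × y ∈ P - x × y ∉ Q)
  hits-P-x (disjoint-f , y , y∈f , y∈P , y∉Q) =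
    y , y∈f , x∈p∧x≢y⇒x∈p-y y∈P (λ { refl → disjoint-f x∈e y∈f }) , y∉Q

edge-leaves-stable : ∀ {n} {A : Adj n} {S e} → Stable A S → A (proj₁ e) (proj₂ e) ≡ true →
  ∃[ x ] (x ∈ₑ e × x ∉ S)
edge-leaves-stable {S = S} {a , b} st adjacent with a ∈? S | b ∈? S
... | no a∉S | _ = a , inj₁ refl , a∉S
... | yes _ | no b∉S = b , inj₂ refl , b∉S
... | yes a∈S | yes b∈S = contradiction (trans (sym adjacent) (st a∈S b∈S)) λ ()

stable-matching-bound : ∀ {n} {T : Subset n} {L} → Matching L →
  All (λ e → ∃[ x ] (x ∈ₑ e × x ∉ T)) L → ∣ T ∣ + length L ≤ n
stable-matching-bound {n} {T} {L} m leaves = begin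
  ∣ T ∣ + length L          ≤⟨ +-monoʳ-≤ ∣ T ∣ L≤∣∁T∣ ⟩
  ∣ T ∣ + ∣ ∁ T ∣            ≡⟨ cong (∣ T ∣ +_) (∣∁p∣≡n∸∣p∣ T) ⟩
  ∣ T ∣ + (n ∸ ∣ T ∣)        ≡⟨ m+[n∸m]≡n (∣p∣≤n T) ⟩
  n                         ∎
  where
  open ≤-Reasoning
  L≤∣∁T∣ : length L ≤ ∣ ∁ T ∣
  L≤∣∁T∣ = subst (_≤ ∣ ∁ T ∣) (cong (_+ length L) (∣⊥∣≡0 n))
    (matching-bound ⊥⊆ m (All.map (λ { (x , x∈e , x∉T) → x , x∈e , x∉p⇒x∈∁p x∉T , ∉⊥ }) leaves))

-- Edges of a graph

edges⁻ : (G : Graph) {e : Edge (n G)} → e ∈ₗ edges G →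
  toℕ (proj₁ e) < toℕ (proj₂ e) × adj G (proj₁ e) (proj₂ e) ≡ true
edges⁻ G {a , b} e∈E
  with ∧-true (proj₂ (∈-filter⁻ _ {xs = concatMap (λ i → map (i ,_) (allFin (n G))) (allFin (n G))} e∈E))
... | ordered , adjacent = <ᵇ⇒< (toℕ a) (toℕ b) (T-≡ .from ordered) , adjacent

edges-unique : (G : Graph) → Unique (edges G)
edges-unique G = Unique.filter⁺ _ $
  subst Unique (sym (concatMap-pairs≡cartesianProduct (allFin (n G)) (allFin (n G))))
    (Unique.cartesianProduct⁺ (Unique.allFin⁺ (n G)) (Unique.allFin⁺ (n G)))

adjacent⇒≢ : (G : Graph) {a b : Fin (n G)} → adj G a b ≡ true → a ≢ b
adjacent⇒≢ G {a} adjacent refl = contradiction (trans (sym adjacent) (irrefl G a)) λ ()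

maximum-matching : (G : Graph) → ∃[ M ] (M ⊆ₗ edges G × Matching M × length M ≡ μ G)
maximum-matching G
  with maximum-attained length (filter (λ M → isMatching M Bool.≟ true) (sublists (edges G)))
... | inj₁ max≡0 = [] , (λ ()) , [] , sym max≡0
... | inj₂ (M , M∈ , ∣M∣≡max) with ∈-filter⁻ _ {xs = sublists (edges G)} M∈
...   | M∈sublists , matching =
  M , sublists-⊆ (edges G) M∈sublists , isMatching-sound matching , ∣M∣≡max

-- Deleting an edge

deleteEdge-false : ∀ {n} (A : Adj n) (e : Edge n) {i j} → deleteEdge A e i j ≡ false →
  A i j ≡ false ⊎ (i ≡ proj₁ e × j ≡ proj₂ e) ⊎ (i ≡ proj₂ e × j ≡ proj₁ e)
deleteEdge-false A (u , v) {i} {j} h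
  with A i j | i == u ∧ j == v in forward | i == v ∧ j == u in backward
... | false | _ | _ = inj₁ refl
... | true | true | _ = inj₂ (inj₁ (==∧==-sound forward))
... | true | false | true = inj₂ (inj₂ (==∧==-sound backward))
deleteEdge-false A (u , v) () | true | false | false

endpoint∈ : ∀ {n} {T : Subset n} {e x} → proj₁ e ∈ T → proj₂ e ∈ T → x ∈ₑ e → x ∈ T
endpoint∈ u∈T _ (inj₁ refl) = u∈T
endpoint∈ _ v∈T (inj₂ refl) = v∈T

stable-deleteEdge⁻ : ∀ {n} {A : Adj n} {e T x} → Stable (deleteEdge A e) T → x ∈ₑ e → x ∉ T →
  Stable A T
stable-deleteEdge⁻ {A = A} {e} st x∈e x∉T i∈T j∈T with deleteEdge-false A e (st i∈T j∈T)
... | inj₁ not-adjacent = not-adjacent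
... | inj₂ (inj₁ (refl , refl)) = contradiction (endpoint∈ i∈T j∈T x∈e) x∉T
... | inj₂ (inj₂ (refl , refl)) = contradiction (endpoint∈ j∈T i∈T x∈e) x∉T

deleteEdge-keeps : (G : Graph) {e f : Edge (n G)} → e ∈ₗ edges G → f ∈ₗ edges G → f ≢ e →
  deleteEdge (adj G) e (proj₁ f) (proj₂ f) ≡ true
deleteEdge-keeps G {e} {f} e∈E f∈E f≢e = ¬-not removed⇒⊥
  where
  removed⇒⊥ : deleteEdge (adj G) e (proj₁ f) (proj₂ f) ≢ false
  removed⇒⊥ removed with deleteEdge-false (adj G) e removed
  ... | inj₁ not-adjacent = contradiction (trans (sym (proj₂ (edges⁻ G f∈E))) not-adjacent) λ ()
  ... | inj₂ (inj₁ (f₁≡e₁ , f₂≡e₂)) = f≢e (cong₂ _,_ f₁≡e₁ f₂≡e₂)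
  ... | inj₂ (inj₂ (f₁≡e₂ , f₂≡e₁)) =
    <-asym (proj₁ (edges⁻ G e∈E)) (subst₂ (λ a b → toℕ a < toℕ b) f₁≡e₂ f₂≡e₁ (proj₁ (edges⁻ G f∈E)))

-- König–Egerváry graphs

∣∁S∣≡μ : (G : Graph) → IsKE G → ∀ {S} → S ∈ₗ Ω G → ∣ ∁ S ∣ ≡ μ G
∣∁S∣≡μ G ke {S} S∈Ω = begin
  ∣ ∁ S ∣          ≡⟨ ∣∁p∣≡n∸∣p∣ S ⟩
  n G ∸ ∣ S ∣      ≡⟨ cong₂ _∸_ (sym ke) (proj₂ (∈Ω⁻ G S∈Ω)) ⟩
  α G + μ G ∸ α G  ≡⟨ m+n∸m≡n (α G) (μ G) ⟩
  μ G              ∎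
  where open ≡-Reasoning

maximum-matching-meets-maximum-stable : (G : Graph) → IsKE G → ∀ {S M e} → S ∈ₗ Ω G →
  M ⊆ₗ edges G → Matching M → length M ≡ μ G → e ∈ₗ M → ∃[ x ] (x ∈ₑ e × x ∈ S)
maximum-matching-meets-maximum-stable G ke {S} {M} {e} S∈Ω M⊆E m ∣M∣≡μ e∈M
  with proj₁ e ∈? S | proj₂ e ∈? S
... | yes u∈S | _ = proj₁ e , inj₁ refl , u∈S
... | no _ | yes v∈S = proj₂ e , inj₂ refl , v∈S
... | no u∉S | no v∉S = contradiction too-many (<-irrefl refl)
  where
  adjacent : ∀ {f} → f ∈ₗ M → adj G (proj₁ f) (proj₂ f) ≡ true
  adjacent = proj₂ ∘ edges⁻ G ∘ M⊆E
  hit : ∀ {f} → f ∈ₗ M → ∃[ x ] (x ∈ₑ f × x ∈ ∁ S × x ∉ ⁅ proj₁ e ⁆)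
  hit {f} f∈M with f ≟ₑ e
  ... | yes refl = proj₂ e , inj₂ refl , x∉p⇒x∈∁p v∉S ,
                   λ v∈⁅u⁆ → adjacent⇒≢ G (adjacent e∈M) (sym (x∈⁅y⁆⇒x≡y _ v∈⁅u⁆))
  ... | no f≢e with edge-leaves-stable (proj₁ (∈Ω⁻ G S∈Ω)) (adjacent f∈M)
  ...   | x , x∈f , x∉S = x , x∈f , x∉p⇒x∈∁p x∉S , λ x∈⁅u⁆ →
    matching-disjoint m e∈M f∈M (f≢e ∘ sym) (inj₁ (x∈⁅y⁆⇒x≡y _ x∈⁅u⁆)) x∈f
  ⁅u⁆⊆∁S : ⁅ proj₁ e ⁆ ⊆ ∁ S
  ⁅u⁆⊆∁S y∈⁅u⁆ = subst (_∈ ∁ S) (sym (x∈⁅y⁆⇒x≡y _ y∈⁅u⁆)) (x∉p⇒x∈∁p u∉S)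
  too-many : 1 + μ G ≤ μ G
  too-many = subst₂ _≤_ (cong₂ _+_ (∣⁅x⁆∣≡1 (proj₁ e)) ∣M∣≡μ) (∣∁S∣≡μ G ke S∈Ω)
               (matching-bound ⁅u⁆⊆∁S m (All.tabulate hit))

-- α-critical edges

criticalEdges : (G : Graph) → List (Edge (n G))
criticalEdges G = filter (λ e → isαCritical G e Bool.≟ true) (edges G)

criticalEdges⁻ : (G : Graph) {e : Edge (n G)} → e ∈ₗ criticalEdges G →
  e ∈ₗ edges G × α G < αA (deleteEdge (adj G) e)
criticalEdges⁻ G e∈C with ∈-filter⁻ _ {xs = edges G} e∈C
... | e∈E , critical = e∈E , <ᵇ⇒< _ _ (T-≡ .from critical)

module CriticalEdge (G : Graph) {e : Edge (n G)} (e∈C : e ∈ₗ criticalEdges G) where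

  private
    e∈E : e ∈ₗ edges G
    e∈E = proj₁ (criticalEdges⁻ G e∈C)

    u≢v : proj₁ e ≢ proj₂ e
    u≢v = adjacent⇒≢ G (proj₂ (edges⁻ G e∈E))

    witness = αA-attained (deleteEdge (adj G) e)

    T : Subset (n G)
    T = proj₁ witness

    T-stable : Stable (deleteEdge (adj G) e) T
    T-stable = proj₁ (proj₂ witness)

    α<∣T∣ : α G < ∣ T ∣
    α<∣T∣ = subst (α G <_) (sym (proj₂ (proj₂ witness))) (proj₂ (criticalEdges⁻ G e∈C))

    endpoint∈T : ∀ {x} → x ∈ₑ e → x ∈ T
    endpoint∈T {x} x∈e with x ∈? T
    ... | yes x∈T = x∈T
    ... | no x∉T = contradiction (stable-size≤αA (stable-deleteEdge⁻ T-stable x∈e x∉T)) (<⇒≱ α<∣T∣)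

    T-endpoint∈Ω : ∀ {x} → x ∈ₑ e → T - x ∈ₗ Ω G
    T-endpoint∈Ω {x} x∈e = ∈Ω⁺ G stable (≤-antisym (stable-size≤αA stable) α≤∣T-x∣)
      where
      stable : Stable (adj G) (T - x)
      stable = stable-deleteEdge⁻ (λ i∈ j∈ → T-stable (p─q⊆p T ⁅ x ⁆ i∈) (p─q⊆p T ⁅ x ⁆ j∈))
                                  x∈e (x∉p-x T x)
      α≤∣T-x∣ : α G ≤ ∣ T - x ∣
      α≤∣T-x∣ = s≤s⁻¹ (subst (α G <_) (∣p∣≡1+∣p-x∣ (endpoint∈T x∈e)) α<∣T∣)

    other-endpoint : ∀ {x} → x ∈ₑ e → ∃[ y ] (y ∈ₑ e × x ∈ T - y)
    other-endpoint (inj₁ refl) = proj₂ e , inj₂ refl , x∈p∧x≢y⇒x∈p-y (endpoint∈T (inj₁ refl)) u≢v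
    other-endpoint (inj₂ refl) = proj₁ e , inj₁ refl , x∈p∧x≢y⇒x∈p-y (endpoint∈T (inj₂ refl)) (u≢v ∘ sym)

  endpoint∉core : ∀ {x} → x ∈ₑ e → x ∉ core G
  endpoint∉core {x} x∈e x∈core = x∉p-x T x (core⊆ G (T-endpoint∈Ω x∈e) x∈core)

  endpoint∉anticore : ∀ {x} → x ∈ₑ e → x ∉ anticore G
  endpoint∉anticore x∈e x∈anticore with other-endpoint x∈e
  ... | y , y∈e , x∈T-y = x∈∁p⇒x∉p (anticore⊆∁ G (T-endpoint∈Ω y∈e) x∈anticore) x∈T-y

  ∈-maximum-matching : IsKE G → ∀ {M} → M ⊆ₗ edges G → Matching M → length M ≡ μ G → e ∈ₗ M
  ∈-maximum-matching ke {M} M⊆E m ∣M∣≡μ with Any.any? (e ≟ₑ_) M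
  ... | yes e∈M = e∈M
  ... | no e∉M = contradiction (stable-matching-bound m (All.tabulate leaves)) (<⇒≱ too-large)
    where
    leaves : ∀ {f} → f ∈ₗ M → ∃[ x ] (x ∈ₑ f × x ∉ T)
    leaves f∈M = edge-leaves-stable T-stable (deleteEdge-keeps G e∈E (M⊆E f∈M) λ { refl → e∉M f∈M })
    too-large : n G < ∣ T ∣ + length M
    too-large = subst (_< ∣ T ∣ + length M) (trans (cong (α G +_) ∣M∣≡μ) ke)
                  (+-monoˡ-< (length M) α<∣T∣)

critical⊆maximum-matching : (G : Graph) → IsKE G → ∀ {M} → M ⊆ₗ edges G → Matching M →
  length M ≡ μ G → criticalEdges G ⊆ₗ M
critical⊆maximum-matching G ke M⊆E m ∣M∣≡μ e∈C = CriticalEdge.∈-maximum-matching G e∈C ke M⊆E m ∣M∣≡μ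

criticalEdges-matching : (G : Graph) → IsKE G → Matching (criticalEdges G)
criticalEdges-matching G ke with maximum-matching G
... | M , M⊆E , m , ∣M∣≡μ =
  matching-⊆ (Unique.filter⁺ _ (edges-unique G)) (critical⊆maximum-matching G ke M⊆E m ∣M∣≡μ) m

ξ+η≤α : (G : Graph) → IsKE G → ξ G + η G ≤ α G
ξ+η≤α G ke with maximum-stable G | maximum-matching G
... | S , S∈Ω | M , M⊆E , m , ∣M∣≡μ =
  subst₂ _≤_ (cong (_+ η G) (sym (ξ≡∣core∣ G))) (proj₂ (∈Ω⁻ G S∈Ω))
    (matching-bound (core⊆ G S∈Ω) (criticalEdges-matching G ke) (All.tabulate hit))
  where
  hit : ∀ {e} → e ∈ₗ criticalEdges G → ∃[ x ] (x ∈ₑ e × x ∈ S × x ∉ core G)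
  hit e∈C with maximum-matching-meets-maximum-stable G ke S∈Ω M⊆E m ∣M∣≡μ
                 (critical⊆maximum-matching G ke M⊆E m ∣M∣≡μ e∈C)
  ... | x , x∈e , x∈S = x , x∈e , x∈S , CriticalEdge.endpoint∉core G e∈C x∈e

σ+η≤μ : (G : Graph) → IsKE G → σ G + η G ≤ μ G
σ+η≤μ G ke with maximum-stable G
... | S , S∈Ω =
  subst₂ _≤_ (cong (_+ η G) (sym (σ≡∣anticore∣ G))) (∣∁S∣≡μ G ke S∈Ω)
    (matching-bound (anticore⊆∁ G S∈Ω) (criticalEdges-matching G ke) (All.tabulate hit))
  where
  hit : ∀ {e} → e ∈ₗ criticalEdges G → ∃[ x ] (x ∈ₑ e × x ∈ ∁ S × x ∉ anticore G)
  hit e∈C with edge-leaves-stable (proj₁ (∈Ω⁻ G S∈Ω)) (proj₂ (edges⁻ G (proj₁ (criticalEdges⁻ G e∈C))))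
  ... | x , x∈e , x∉S = x , x∈e , x∉p⇒x∈∁p x∉S , CriticalEdge.endpoint∉anticore G e∈C x∈e

proposition3p5 : (G : Graph) → IsKE G →
    (ξ G + η G ≤ α G) × (σ G + η G ≤ μ G) × (ξ G + 2 * η G + σ G ≤ n G)
proposition3p5 G ke = ξ+η≤α G ke , σ+η≤μ G ke , (begin
  ξ G + 2 * η G + σ G        ≡⟨ solve 3 (λ x y z → x :+ con 2 :* y :+ z := (x :+ y) :+ (z :+ y))
                                        refl (ξ G) (η G) (σ G) ⟩
  (ξ G + η G) + (σ G + η G)  ≤⟨ +-mono-≤ (ξ+η≤α G ke) (σ+η≤μ G ke) ⟩
  α G + μ G                  ≡⟨ ke ⟩
  n G                        ∎)
  where
  open ≤-Reasoning
  open +-*-Solver
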